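{- Let $\mathrm{Halt}(m,n)$ be the primitive recursive predicate "the $m$-th Turing machine, started on the empty tape, stops before $n$ evaluation steps", and let $f$ be a function symbol denoting a primitive recursive function $\mathbb N^3\to\mathbb N$ such that $f(m,n,p)=0$ iff $(n>0\wedge\mathrm{Halt}(m,n))\vee(n=0\wedge\neg\mathrm{Halt}(m,p))$. Let $\Theta$ be a closed $\lambda$-term such that for all $m,n\in\mathbb N$, $t_0,t_1\in\Lambda$, $\pi\in\Pi$: $\Theta\star\bar m\cdot\bar n\cdot t_0\cdot t_1\cdot\pi\succ t_0\star\pi$ if $\mathrm{Halt}(m,n)$, and $\Theta\star\bar m\cdot\bar n\cdot t_0\cdot t_1\cdot\pi\succ t_1\star\pi$ otherwise. Define $T[m,u,k]\equiv\lambda pv.\,\Theta\,m\,p\,(k\,(u\,p\,(\lambda pv.v)))\,v$ and $t_H\equiv\lambda mu.\,\mathrm{cc}\,(\lambda k.\,u\,\bar 0\,T[m,u,k])$. Then $t_H$ universally realizes $\Phi_H\equiv\forall^{\mathsf N}x\,\exists^{\mathsf N}y\,\forall^{\mathsf N}z\,(f(x,y,z)=0)$.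
   Context: Fix an instance of Krivine's $\lambda_c$-calculus: terms $t,u::=x\mid \lambda x.t\mid tu\mid k_\pi\mid\kappa$ ($\kappa$ in a countable set of instructions containing $\mathrm{cc}$, $k_\pi$ continuation constants), stacks $\pi::=\alpha\mid t\cdot\pi$; $\Lambda$ closed terms, $\Pi$ stacks, processes $t\star\pi$. One-step evaluation $\succ_1$ satisfies at least $tu\star\pi\succ_1 t\star u\cdot\pi$, $\lambda x.t\star u\cdot\pi\succ_1 t\{x:=u\}\star\pi$, $\mathrm{cc}\star t\cdot\pi\succ_1 t\star k_\pi\cdot\pi$, $k_\pi\star t\cdot\pi'\succ_1 t\star\pi$; $\succ$ its reflexive-transitive closure. $\bar n\equiv\bar s^n\bar 0$, $\bar 0\equiv\lambda xf.x$, $\bar s\equiv\lambda nxf.f(nxf)$. A pole is $\perp\!\!\!\perp\subseteq\Lambda\times\Pi$ closed under anti-evaluation. For a pole: $\|\dot F(\vec e)\|=F([\![\vec e]\!])$ for $F:\mathbb N^k\to\mathcal P(\Pi)$, $\|A\Rightarrow B\|=\{t\cdot\pi:t\in|A|,\pi\in\|B\|\}$, $\|\forall xA\|=\bigcup_n\|A\{x:=n\}\|$, $\|\forall XA\|=\bigcup_F\|A\{X:=\dot F\}\|$, $\|\{e\}\Rightarrow A\|=\{\bar n\cdot\pi:n=[\![e]\!],\pi\in\|A\|\}$, $|A|=\{t:\forall\pi\in\|A\|,\ t\star\pi\in\perp\!\!\!\perp\}$; $t$ universally realizes $A$ if $t\in|A|$ for all poles. $\forall^{\mathsf N}xA\equiv\forall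 x(\{x\}\Rightarrow A)$, $\exists^{\mathsf N}xA\equiv\forall Z(\forall x(\{x\}\Rightarrow A\Rightarrow Z)\Rightarrow Z)$, $e_1=e_2\equiv\forall W(W(e_1)\Rightarrow W(e_2))$ with $W$ unary. -}

module Defs where

open import Level using (Lift; lift; _⊔_) renaming (suc to lsuc; zero to lzero)
open import Data.Nat using (ℕ; zero; suc; _>_)
open import Data.Fin using (Fin; zero; suc; #_)
open import Data.Bool using (Bool; true; false; if_then_else_)
open import Data.Maybe using (Maybe; just; nothing; _>>=_)
open import Data.Integer using (ℤ; +_; _+_; _-_; 0ℤ; 1ℤ)
open import Data.Integer.Properties using () renaming (_≟_ to _≟ℤ_)
open import Data.Product using (Σ; _×_; _,_)
open import Data.Sum using (_⊎_)
open import Relation.Nullary using (¬_; does)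
open import Relation.Binary.PropositionalEquality using (_≡_)
open import Relation.Binary.Construct.Closure.ReflexiveTransitive using (Star)
open import Function.Definitions using (Injective)

-- Turing machines (binary alphabet, start state 0, empty (all-false) tape)

data Move : Set where
  left right : Move

record TM : Set where
  field
    -- transition: state, scanned symbol ↦ nothing (= no transition: halt)
    -- or (new state, written symbol, head move)
    δ : ℕ → Bool → Maybe (ℕ × Bool × Move)

record Config : Set where
  constructor config
  field
    state : ℕ
    head  : ℤ
    tape  : ℤ → Bool

initConfig : Config
initConfig = config 0 0ℤ (λ _ → false)

stepTM : TM → Config → Maybe Config
stepTM M (config q h τ) with TM.δ M q (τ h)
... | nothing = nothing
... | just (q' , b , d) =
  just (config q' (mv d) (λ i → if does (i ≟ℤ h) then b else τ i))
  where
  mv : Move → ℤ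
  mv left  = h - 1ℤ
  mv right = h + 1ℤ

-- configuration after n steps (nothing if the machine stopped earlier)
runTM : TM → ℕ → Maybe Config
runTM M zero    = just initConfig
runTM M (suc n) = runTM M n >>= stepTM M

Halt : (ℕ → TM) → ℕ → ℕ → Set
Halt tm m n = runTM (tm m) n ≡ nothing

record LambdaC : Set₁ where
  field
    Instr     : Set
    instrCode : Instr → ℕ                 -- countability of instructions
    instrCode-inj : Injective _≡_ _≡_ instrCode
    cc        : Instr
    StConst   : Set

module _ (L : LambdaC) where
  open LambdaC L

  mutual
    data Term : ℕ → Set where
      var : ∀ {n} → Fin n → Term n
      lam : ∀ {n} → Term (suc n) → Term n
      app : ∀ {n} → Term n → Term n → Term n
      kπ  : ∀ {n} → Stack → Term n
      ins : ∀ {n} → Instr → Term n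

    data Stack : Set where
      stc : StConst → Stack
      _∙_ : Term 0 → Stack → Stack

  infixr 5 _∙_

module _ {L : LambdaC} where
  open LambdaC L

  ext : ∀ {m n} → (Fin m → Fin n) → Fin (suc m) → Fin (suc n)
  ext ρ zero    = zero
  ext ρ (suc i) = suc (ρ i)

  rename : ∀ {m n} → (Fin m → Fin n) → Term L m → Term L n
  rename ρ (var i)   = var (ρ i)
  rename ρ (lam t)   = lam (rename (ext ρ) t)
  rename ρ (app t u) = app (rename ρ t) (rename ρ u)
  rename ρ (kπ π)    = kπ π
  rename ρ (ins κ)   = ins κ

  exts : ∀ {m n} → (Fin m → Term L n) → Fin (suc m) → Term L (suc n)
  exts σ zero    = var zero
  exts σ (suc i) = rename suc (σ i)

  subst : ∀ {m n} → (Fin m → Term L n) → Term L m → Term L n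
  subst σ (var i)   = σ i
  subst σ (lam t)   = lam (subst (exts σ) t)
  subst σ (app t u) = app (subst σ t) (subst σ u)
  subst σ (kπ π)    = kπ π
  subst σ (ins κ)   = ins κ

  _[_] : Term L 1 → Term L 0 → Term L 0
  t [ u ] = subst (λ { zero → u ; (suc ()) }) t

  weaken : ∀ {n} → Term L 0 → Term L n
  weaken = rename (λ ())

  record Process : Set where
    constructor _⋆_
    field
      term  : Term L 0
      stack : Stack L

  -- 0̄ ≡ λxf.x,  s̄ ≡ λnxf.f(nxf),  n̄ ≡ s̄ⁿ 0̄
  zeroT : ∀ {n} → Term L n
  zeroT = lam (lam (var (suc zero)))

  sucT : ∀ {n} → Term L n
  sucT = lam (lam (lam (app (var zero) (app (app (var (# 2)) (var (# 1))) (var zero)))))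

  num : ℕ → Term L 0
  num zero    = zeroT
  num (suc n) = app sucT (num n)

-- an evaluation relation ≻₁ satisfying (at least) the four basic rules
record Eval (L : LambdaC) : Set₁ where
  open LambdaC L
  field
    _≻₁_ : Process {L} → Process {L} → Set
    push : ∀ {t u : Term L 0} {π} → (app t u ⋆ π) ≻₁ (t ⋆ (u ∙ π))
    grab : ∀ {t : Term L 1} {u π} → (lam t ⋆ (u ∙ π)) ≻₁ ((t [ u ]) ⋆ π)
    save : ∀ {t : Term L 0} {π} → (ins cc ⋆ (t ∙ π)) ≻₁ (t ⋆ (kπ π ∙ π))
    rest : ∀ {π} {t : Term L 0} {π'} → (kπ π ⋆ (t ∙ π')) ≻₁ (t ⋆ π)

  _≻_ : Process {L} → Process {L} → Set
  _≻_ = Star _≻₁_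

record Pole {L : LambdaC} (ev : Eval L) : Set₁ where
  open Eval ev
  field
    ⊥⊥   : Term L 0 → Stack L → Set
    anti : ∀ {t π t' π'} → (t ⋆ π) ≻ (t' ⋆ π') → ⊥⊥ t' π' → ⊥⊥ t π

module Sem {L : LambdaC} (⊥⊥ : Term L 0 → Stack L → Set) where

  FV : Set₂
  FV = Stack L → Set₁

  ∣_∣ : FV → Term L 0 → Set₁
  ∣ A ∣ t = ∀ π → A π → Lift (lsuc lzero) (⊥⊥ t π)

  atom₀ : (Stack L → Set) → FV
  atom₀ F π = Lift (lsuc lzero) (F π)

  atom₁ : (ℕ → Stack L → Set) → ℕ → FV
  atom₁ F e π = Lift (lsuc lzero) (F e π)

  _⇒_ : FV → FV → FV
  (A ⇒ B) π = Σ (Term L 0) λ t → Σ (Stack L) λ π' → (π ≡ t ∙ π') × ∣ A ∣ t × B π'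
  infixr 4 _⇒_

  ⟨_⟩⇒_ : ℕ → FV → FV
  (⟨ e ⟩⇒ A) π = Σ (Stack L) λ π' → (π ≡ num e ∙ π') × A π'
  infixr 4 ⟨_⟩⇒_

  ∀₁ : (ℕ → FV) → FV
  ∀₁ A π = Σ ℕ λ n → A n π

  ∀X₀ : ((Stack L → Set) → FV) → FV
  ∀X₀ A π = Σ (Stack L → Set) λ F → A F π

  ∀X₁ : ((ℕ → Stack L → Set) → FV) → FV
  ∀X₁ A π = Σ (ℕ → Stack L → Set) λ F → A F π

  ∀ᴺ : (ℕ → FV) → FV
  ∀ᴺ A = ∀₁ λ x → ⟨ x ⟩⇒ A x

  ∃ᴺ : (ℕ → FV) → FV
  ∃ᴺ A = ∀X₀ λ Z → (∀₁ λ x → ⟨ x ⟩⇒ (A x ⇒ atom₀ Z)) ⇒ atom₀ Z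

  _≐_ : ℕ → ℕ → FV
  e₁ ≐ e₂ = ∀X₁ λ W → atom₁ W e₁ ⇒ atom₁ W e₂

  ΦH : (ℕ → ℕ → ℕ → ℕ) → FV
  ΦH f = ∀ᴺ λ x → ∃ᴺ λ y → ∀ᴺ λ z → f x y z ≐ 0

UnivRealizes : {L : LambdaC} (ev : Eval L) → Term L 0
             → ((⊥⊥ : Term L 0 → Stack L → Set) → Sem.FV ⊥⊥) → Set₁
UnivRealizes ev t A = (P : Pole ev) → Sem.∣_∣ (Pole.⊥⊥ P) (A (Pole.⊥⊥ P)) t

module _ {L : LambdaC} where
  open LambdaC L

  idT : ∀ {n} → Term L n
  idT = lam (lam (var zero))

  -- T[m,u,k] ≡ λpv. Θ m p (k (u p (λpv.v))) v
  -- in scope (k = 0, u = 1, m = 2); inside λpv: v = 0, p = 1, k = 2, u = 3, m = 4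
  TT : Term L 0 → Term L 3
  TT Θ = lam (lam
    (app (app (app (app (weaken Θ) (var (# 4))) (var (# 1)))
              (app (var (# 2)) (app (app (var (# 3)) (var (# 1))) idT)))
         (var zero)))

  -- t_H ≡ λmu. cc (λk. u 0̄ T[m,u,k])
  tH : Term L 0 → Term L 0
  tH Θ = lam (lam (app (ins cc) (lam (app (app (var (# 1)) zeroT) (TT Θ)))))

ThetaSpec : {L : LambdaC} → Eval L → (ℕ → TM) → Term L 0 → Set
ThetaSpec {L} ev tm Θ =
  ∀ (m n : ℕ) (t₀ t₁ : Term L 0) (π : Stack L) →
    (Halt tm m n → (Θ ⋆ (num m ∙ num n ∙ t₀ ∙ t₁ ∙ π)) ≻ (t₀ ⋆ π))
  × (¬ Halt tm m n → (Θ ⋆ (num m ∙ num n ∙ t₀ ∙ t₁ ∙ π)) ≻ (t₁ ⋆ π))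
  where open Eval ev

FSpec : (ℕ → TM) → (ℕ → ℕ → ℕ → ℕ) → Set
FSpec tm f = ∀ m n p →
  (f m n p ≡ 0 → ((n > 0 × Halt tm m n) ⊎ (n ≡ 0 × ¬ Halt tm m p)))
  × (((n > 0 × Halt tm m n) ⊎ (n ≡ 0 × ¬ Halt tm m p)) → f m n p ≡ 0)

module Submission where

-- A stack of ‖Φ_H‖ has the form  m̄ · u · π  where u realizes
-- ∀y({y} ⇒ A(y) ⇒ Z), π ∈ ‖Z‖ and A(y) ≡ ∀ᴺz (f(m,y,z) = 0).  Then
--   t_H ⋆ m̄·u·π  ≻  u ⋆ 0̄ · T[m,u,k_π] · π,
-- so it suffices that T[m,u,k_π] realizes A(0).  Against p̄ · v · ρ with
-- v ∈ |W(f(m,0,p))| and ρ ∈ ‖W(0)‖, T runs Θ on m̄, p̄: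
--  * if Halt(m,p), the continuation k_π is invoked, which backtracks to
--    u ⋆ p̄ · (λpv.v) · π; here p > 0, so f(m,p,z) = 0 for all z and the
--    identity λpv.v realizes A(p);
--  * otherwise Θ hands control to v ⋆ ρ, and f(m,0,p) = 0 turns v into a
--    realizer of W(0).

open import Defs
open import Level using (lift; lower)
open import Data.Nat using (ℕ; zero; suc; _>_; s≤s; z≤n)
open import Data.Fin using (Fin; zero; suc; #_)
open import Data.Product using (_,_; proj₁; proj₂)
open import Data.Sum using (inj₁; inj₂)
open import Data.Maybe using (just; nothing)
open import Relation.Nullary using (¬_; Dec; yes; no)
open import Relation.Binary.PropositionalEquality
  using (_≡_; refl; cong; cong₂)
open import Relation.Binary.Construct.Closure.ReflexiveTransitive
  using (ε; _◅_; _◅◅_)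

module Syntax {L : LambdaC} where

  rename-cong : ∀ {m n} {ρ ρ' : Fin m → Fin n} → (∀ i → ρ i ≡ ρ' i) →
                (t : Term L m) → rename ρ t ≡ rename ρ' t
  rename-cong h (var i)   = cong var (h i)
  rename-cong h (lam t)   = cong lam (rename-cong (λ { zero → refl ; (suc i) → cong suc (h i) }) t)
  rename-cong h (app t u) = cong₂ app (rename-cong h t) (rename-cong h u)
  rename-cong h (kπ π)    = refl
  rename-cong h (ins κ)   = refl

  rename-id : ∀ {m} {ρ : Fin m → Fin m} → (∀ i → ρ i ≡ i) →
              (t : Term L m) → rename ρ t ≡ t
  rename-id h (var i)   = cong var (h i)
  rename-id h (lam t)   = cong lam (rename-id (λ { zero → refl ; (suc i) → cong suc (h i) }) t)
  rename-id h (app t u) = cong₂ app (rename-id h t) (rename-id h u)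
  rename-id h (kπ π)    = refl
  rename-id h (ins κ)   = refl

  rename-fusion : ∀ {k m n} {ρ : Fin m → Fin n} {ρ' : Fin k → Fin m}
                  {ρ'' : Fin k → Fin n} → (∀ i → ρ (ρ' i) ≡ ρ'' i) →
                  (t : Term L k) → rename ρ (rename ρ' t) ≡ rename ρ'' t
  rename-fusion h (var i)   = cong var (h i)
  rename-fusion h (lam t)   = cong lam (rename-fusion (λ { zero → refl ; (suc i) → cong suc (h i) }) t)
  rename-fusion h (app t u) = cong₂ app (rename-fusion h t) (rename-fusion h u)
  rename-fusion h (kπ π)    = refl
  rename-fusion h (ins κ)   = refl

  subst-rename-var : ∀ {k m n} {σ : Fin m → Term L n} {ρ : Fin k → Fin m}
                     {ρ' : Fin k → Fin n} → (∀ i → σ (ρ i) ≡ var (ρ' i)) →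
                     (t : Term L k) → subst σ (rename ρ t) ≡ rename ρ' t
  subst-rename-var h (var i)   = h i
  subst-rename-var h (lam t)   = cong lam (subst-rename-var (λ { zero → refl ; (suc i) → cong (rename suc) (h i) }) t)
  subst-rename-var h (app t u) = cong₂ app (subst-rename-var h t) (subst-rename-var h u)
  subst-rename-var h (kπ π)    = refl
  subst-rename-var h (ins κ)   = refl

  -- t' Copies t: t' is the closed term t, seen in a larger scope.  Closed
  -- terms are inert under the substitutions performed by evaluation; the
  -- next four lemmas say so.
  _Copies_ : ∀ {n} → Term L n → Term L 0 → Set
  t' Copies t = t' ≡ weaken t

  rename-closed : ∀ {n} (ρ : Fin 0 → Fin n) (t : Term L 0) → rename ρ t Copies t
  rename-closed ρ = rename-cong (λ ())

  rename-copy : ∀ {m n} {ρ : Fin m → Fin n} {t' : Term L m} {t : Term L 0} →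
                t' Copies t → rename ρ t' Copies t
  rename-copy {t = t} refl = rename-fusion (λ ()) t

  subst-copy : ∀ {m n} {σ : Fin m → Term L n} {t' : Term L m} {t : Term L 0} →
               t' Copies t → subst σ t' Copies t
  subst-copy {t = t} refl = subst-rename-var (λ ()) t

  copy-closed : ∀ {t' t : Term L 0} → t' Copies t → t' ≡ t
  copy-closed {t = t} refl = rename-id (λ ()) t

  single : Term L 0 → Fin 1 → Term L 0
  single u i = var i [ u ]

  T[_,_,_,_] : Term L 0 → Term L 0 → Term L 0 → Term L 0 → Term L 0
  T[ Θ , m , u , k ] =
    lam (lam (app (app (app (app (weaken Θ) (weaken m)) (var (# 1)))
                        (app (weaken k) (app (app (weaken u) (var (# 1))) idT)))
                   (var zero)))

  TT-instance : ∀ Θ (σm σu σk : Fin 1 → Term L 0) →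
    subst σk (subst (exts σu) (subst (exts (exts σm)) (TT Θ)))
      ≡ T[ Θ , σm zero , σu zero , σk zero ]
  TT-instance Θ σm σu σk =
    cong lam (cong lam (cong₂ app
      (cong₂ app
        (cong₂ app
          (cong₂ app (subst-copy (subst-copy (subst-copy refl)))           -- Θ
                     (subst-copy (subst-copy (rename-copy (rename-copy
                       (rename-copy (rename-closed suc (σm zero))))))))    -- m
          refl)
        (cong₂ app (rename-copy (rename-closed suc (σk zero)))             -- k
                   (cong₂ app (cong₂ app (subst-copy (rename-copy (rename-copy
                                (rename-closed suc (σu zero)))))            -- u
                                         refl)
                              refl)))
      refl))

module Evaluation {L : LambdaC} (ev : Eval L) where
  open Eval ev
  open Syntax

  ≡-step : ∀ {t t' π π'} → t ≡ t' → π ≡ π' → (t ⋆ π) ≻ (t' ⋆ π')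
  ≡-step refl refl = ε

  idT-eval : ∀ {a b π} → (idT ⋆ (a ∙ b ∙ π)) ≻ (b ⋆ π)
  idT-eval = grab ◅ grab ◅ ε

  kπ-eval : ∀ {π t ρ} → (app (kπ π) t ⋆ ρ) ≻ (t ⋆ π)
  kπ-eval = push ◅ rest ◅ ε

  push₂ : ∀ {t a b π} → (app (app t a) b ⋆ π) ≻ (t ⋆ (a ∙ b ∙ π))
  push₂ = push ◅ push ◅ ε

  tH-eval : ∀ Θ m u π →
            (tH Θ ⋆ (m ∙ u ∙ π)) ≻ (u ⋆ (num 0 ∙ T[ Θ , m , u , kπ π ] ∙ π))
  tH-eval Θ m u π =
    grab ◅ grab ◅ push ◅ save ◅ grab ◅ push ◅ push ◅
    ≡-step (copy-closed (subst-copy (rename-closed suc u)))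
           (cong₂ _∙_ refl (cong₂ _∙_ (TT-instance Θ (single m) (single u) (single (kπ π))) refl))

  T-eval : ∀ Θ m u k p v ρ →
           (T[ Θ , m , u , k ] ⋆ (num p ∙ v ∙ ρ))
             ≻ (Θ ⋆ (m ∙ num p ∙ app k (app (app u (num p)) idT) ∙ v ∙ ρ))
  T-eval Θ m u k p v ρ =
    grab ◅ grab ◅ push ◅ push ◅ push ◅ push ◅
    ≡-step (closed Θ)
           (cong₂ _∙_ (closed m) (cong₂ _∙_ p̄
             (cong₂ _∙_ (cong₂ app (closed k) (cong₂ app (cong₂ app (closed u) p̄) refl))
                        refl)))
    where
    -- the two β-steps substitute p̄ and v; closed subterms are unaffected
    closed : ∀ t → subst (single v) (subst (exts (single (num p))) (weaken t)) ≡ t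
    closed t = copy-closed (subst-copy (subst-copy refl))

    p̄ : subst (single v) (rename suc (num p)) ≡ num p
    p̄ = copy-closed (subst-copy (rename-closed suc (num p)))

module HaltingFacts (tm : ℕ → TM) where

  halt? : ∀ m n → Dec (Halt tm m n)
  halt? m n with runTM (tm m) n
  ... | nothing = yes refl
  ... | just _  = no λ ()

  halt-pos : ∀ {m n} → Halt tm m n → n > 0
  halt-pos {n = zero} ()
  halt-pos {n = suc n} _ = s≤s z≤n

  module _ {f : ℕ → ℕ → ℕ → ℕ} (fs : FSpec tm f) where

    f-halted : ∀ {m p} → Halt tm m p → ∀ z → f m p z ≡ 0
    f-halted {m} {p} h z = proj₂ (fs m p z) (inj₁ (halt-pos h , h))

    f-running : ∀ {m} p → ¬ Halt tm m p → f m 0 p ≡ 0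
    f-running {m} p nh = proj₂ (fs m 0 p) (inj₂ (refl , nh))

module Realizability {L : LambdaC} {ev : Eval L} (P : Pole ev) where
  open Eval ev
  open Pole P
  open Sem ⊥⊥
  open Syntax
  open Evaluation ev

  atom-≡ : ∀ {W a b t} → a ≡ b → ∣ atom₁ W a ∣ t → ∣ atom₁ W b ∣ t
  atom-≡ refl r = r

  idT-realizes-≐ : ∀ (g h : ℕ → ℕ) → (∀ z → g z ≡ h z) →
                   ∣ ∀ᴺ (λ z → g z ≐ h z) ∣ idT
  idT-realizes-≐ g h g≡h _ (z , _ , refl , W , v , ρ , refl , v⊩ , ρ∈) =
    lift (anti idT-eval (lower (atom-≡ {W} (g≡h z) v⊩ ρ ρ∈)))

  module _ (tm : ℕ → TM) (f : ℕ → ℕ → ℕ → ℕ) (fs : FSpec tm f)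
           (Θ : Term L 0) (Θ-spec : ThetaSpec ev tm Θ) where
    open HaltingFacts tm

    A : ℕ → ℕ → FV
    A m y = ∀ᴺ λ z → f m y z ≐ 0

    -- If u realizes ∀y({y} ⇒ A(m,y) ⇒ Z) and π ∈ ‖Z‖, then T[m,u,k_π]
    -- realizes A(m,0): it decides Halt(m,p) through Θ and either backtracks
    -- to u with the better witness p, or uses f(m,0,p) = 0.
    T-realizes : ∀ {m u π Z} →
                 ∣ ∀₁ (λ y → ⟨ y ⟩⇒ (A m y ⇒ atom₀ Z)) ∣ u → atom₀ Z π →
                 ∣ A m 0 ∣ T[ Θ , num m , u , kπ π ]
    T-realizes {m} {u} {π} u⊩ π∈ _ (p , _ , refl , W , v , ρ , refl , v⊩ , ρ∈) =
      lift (anti (T-eval Θ (num m) u (kπ π) p v ρ) (branch (halt? m p)))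
      where
      branch : Dec (Halt tm m p) →
               ⊥⊥ Θ (num m ∙ num p ∙ app (kπ π) (app (app u (num p)) idT) ∙ v ∙ ρ)
      branch (yes h) =
        anti (proj₁ (Θ-spec m p _ v ρ) h ◅◅ kπ-eval ◅◅ push₂)
             (lower (u⊩ _ (p , _ , refl , idT , π , refl ,
                           idT-realizes-≐ _ _ (f-halted fs h) , π∈)))
      branch (no nh) =
        anti (proj₂ (Θ-spec m p _ v ρ) nh) (lower (atom-≡ {W} (f-running fs p nh) v⊩ ρ ρ∈))

    tH-realizes : ∣ ΦH f ∣ (tH Θ)
    tH-realizes _ (m , _ , refl , Z , u , π , refl , u⊩ , π∈) =
      lift (anti (tH-eval Θ (num m) u π)
                 (lower (u⊩ _ (0 , _ , refl , _ , π , refl , T-realizes u⊩ π∈ , π∈))))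

mainTheorem6 : (L : LambdaC) (ev : Eval L) (tm : ℕ → TM)
               (f : ℕ → ℕ → ℕ → ℕ) → FSpec tm f
               → (Θ : Term L 0) → ThetaSpec ev tm Θ
               → UnivRealizes ev (tH Θ) (λ ⊥⊥ → Sem.ΦH ⊥⊥ f)
mainTheorem6 L ev tm f fs Θ Θ-spec P = Realizability.tH-realizes P tm f fs Θ Θ-spec
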